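{- For all integers $n\geq 0$ and $p\geq 0$, \[ \sum_{j=0}^n\binom{j+p}{j}\binom{2(n-j)}{n-j}4^jH_jO_{n-j} = \sum_{j=0}^n\binom{j+p}{j}\binom{2(n-j)}{n-j}4^jO_{n-j}H_{j+p} - \sum_{k=1}^p\frac1k\sum_{j=0}^n\binom{j+p-k}{j}\binom{2(n-j)}{n-j}4^jO_{n-j}. \] In particular, for all integers $n,p\ge 0$, \[ H_{n+p} = H_n + \frac{1}{\binom{n+p}{n}}\sum_{k=1}^p\frac1k\binom{n+p-k}{n}. \]
   Context: $H_n=\sum_{j=1}^n \frac1j$ (with $H_0=0$) and $O_n=\sum_{j=1}^n\frac{1}{2j-1}$ (with $O_0=0$). -}

module Defs where

open import Data.Nat using (ℕ; zero; suc; _∸_; _^_)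
open import Data.Nat.Combinatorics using (_C_)
open import Data.Integer using (+_)
open import Data.Rational using (ℚ; 0ℚ; _+_; _*_; _-_; _/_)

-- reciprocal of a natural number as a rational; convention recip 0 = 0
-- (only ever applied to nonzero arguments below)
recip : ℕ → ℚ
recip zero    = 0ℚ
recip (suc m) = (+ 1) / suc m

ι : ℕ → ℚ
ι m = (+ m) / 1

∑0to : ℕ → (ℕ → ℚ) → ℚ
∑0to zero    f = f 0
∑0to (suc n) f = ∑0to n f + f (suc n)

∑1to : ℕ → (ℕ → ℚ) → ℚ
∑1to zero    f = 0ℚ
∑1to (suc p) f = ∑1to p f + f (suc p)

H : ℕ → ℚ
H n = ∑1to n recip

O : ℕ → ℚ
O n = ∑1to n (λ j → recip (2 Data.Nat.* j ∸ 1))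

-- Put D(n,p) = C(n+p,n)·(H_{n+p} − H_n) and F(n,p) = Σ_{k=1}^p (1/k)·C(n+p−k,n).
-- Both vanish at p = 0, both equal H_p at n = 0, and both satisfy the Pascal
-- recurrence f(n+1,p+1) = f(n,p+1) + f(n+1,p): for F this is Pascal's rule termwise,
-- for D it is Pascal's rule together with the absorption identity
-- C(m+1,k+1)/(m+1) = C(m,k)/(k+1). Hence D = F, which is the second identity after
-- dividing by C(n+p,n). The first identity is D(j,p) = F(j,p) summed against the
-- weights C(2(n−j),n−j)·4^j·O_{n−j}, after exchanging the sums over j and k.
module Submission where

open import Defs
open import Data.Nat using (ℕ; _∸_; _^_)
open import Data.Nat.Combinatorics using (_C_)
open import Data.Product using (_×_)
open import Relation.Binary.PropositionalEquality using (_≡_)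
open import Data.Rational using (ℚ; _+_; _*_; _-_)

open import Data.Nat as ℕ using (zero; suc; _≤_; _<_; z≤n; s≤s; NonZero)
import Data.Nat.Properties as ℕ
open import Data.Nat.Tactic.RingSolver using (solve-∀)
open import Data.Nat.Combinatorics
  using (nCk+nC[k+1]≡[n+1]C[k+1]; nCn≡1; nC1≡n; nCk≡nC[n∸k])
open import Data.Nat.Combinatorics.Specification using (k>n⇒nCk≡0)
import Data.Integer as ℤ
import Data.Integer.Properties as ℤ
open import Data.Rational using (0ℚ; 1ℚ; toℚᵘ)
open import Data.Rational.Properties
  using (toℚᵘ-injective; toℚᵘ-fromℚᵘ; toℚᵘ-homo-+; toℚᵘ-homo-*;
         +-identityʳ; *-identityˡ; *-identityʳ; *-zeroˡ; *-zeroʳ; *-assoc;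
         *-distribˡ-+; *-distribʳ-+)
open import Data.Rational.Solver using (module +-*-Solver)
import Data.Rational.Unnormalised as ℚᵘ
import Data.Rational.Unnormalised.Properties as ℚᵘ
open import Data.Product using (_,_)
import Relation.Binary.Reasoning.Setoid as SetoidReasoning
open import Relation.Binary.PropositionalEquality
  using (refl; sym; trans; cong; cong₂; module ≡-Reasoning)

open +-*-Solver using (solve; _:+_; _:*_; _:-_; _:=_; con)

module ℚᵘ-Reasoning = SetoidReasoning ℚᵘ.≃-setoid

toℚᵘ-ι : ∀ m → toℚᵘ (ι m) ℚᵘ.≃ ℚᵘ.mkℚᵘ (ℤ.+ m) 0
toℚᵘ-ι m = toℚᵘ-fromℚᵘ (ℚᵘ.mkℚᵘ (ℤ.+ m) 0)

ι-homo-+ : ∀ a b → ι (a ℕ.+ b) ≡ ι a + ι b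
ι-homo-+ a b = toℚᵘ-injective (begin
  toℚᵘ (ι (a ℕ.+ b))                         ≈⟨ toℚᵘ-ι (a ℕ.+ b) ⟩
  ℚᵘ.mkℚᵘ (ℤ.+ (a ℕ.+ b)) 0                  ≈⟨ ℚᵘ.*≡* (cong (ℤ._* ℤ.+ 1) pos-+) ⟩
  ℚᵘ.mkℚᵘ (ℤ.+ a) 0 ℚᵘ.+ ℚᵘ.mkℚᵘ (ℤ.+ b) 0   ≈⟨ ℚᵘ.+-cong (ℚᵘ.≃-sym (toℚᵘ-ι a)) (ℚᵘ.≃-sym (toℚᵘ-ι b)) ⟩
  toℚᵘ (ι a) ℚᵘ.+ toℚᵘ (ι b)                 ≈⟨ ℚᵘ.≃-sym (toℚᵘ-homo-+ (ι a) (ι b)) ⟩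
  toℚᵘ (ι a + ι b)                           ∎)
  where
  open ℚᵘ-Reasoning
  pos-+ : ℤ.+ (a ℕ.+ b) ≡ (ℤ.+ a) ℤ.* (ℤ.+ 1) ℤ.+ (ℤ.+ b) ℤ.* (ℤ.+ 1)
  pos-+ = trans (ℤ.pos-+ a b) (sym (cong₂ ℤ._+_ (ℤ.*-identityʳ (ℤ.+ a)) (ℤ.*-identityʳ (ℤ.+ b))))

ι-homo-* : ∀ a b → ι (a ℕ.* b) ≡ ι a * ι b
ι-homo-* a b = toℚᵘ-injective (begin
  toℚᵘ (ι (a ℕ.* b))                         ≈⟨ toℚᵘ-ι (a ℕ.* b) ⟩
  ℚᵘ.mkℚᵘ (ℤ.+ (a ℕ.* b)) 0                  ≈⟨ ℚᵘ.*≡* (cong (ℤ._* ℤ.+ 1) (ℤ.pos-* a b)) ⟩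
  ℚᵘ.mkℚᵘ (ℤ.+ a) 0 ℚᵘ.* ℚᵘ.mkℚᵘ (ℤ.+ b) 0   ≈⟨ ℚᵘ.*-cong (ℚᵘ.≃-sym (toℚᵘ-ι a)) (ℚᵘ.≃-sym (toℚᵘ-ι b)) ⟩
  toℚᵘ (ι a) ℚᵘ.* toℚᵘ (ι b)                 ≈⟨ ℚᵘ.≃-sym (toℚᵘ-homo-* (ι a) (ι b)) ⟩
  toℚᵘ (ι a * ι b)                           ∎)
  where open ℚᵘ-Reasoning

recip-inverseˡ : ∀ m .{{_ : NonZero m}} → recip m * ι m ≡ 1ℚ
recip-inverseˡ (suc m) = toℚᵘ-injective (begin
  toℚᵘ (recip (suc m) * ι (suc m))               ≈⟨ toℚᵘ-homo-* (recip (suc m)) (ι (suc m)) ⟩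
  toℚᵘ (recip (suc m)) ℚᵘ.* toℚᵘ (ι (suc m))     ≈⟨ ℚᵘ.*-cong (toℚᵘ-fromℚᵘ (ℚᵘ.mkℚᵘ (ℤ.+ 1) m)) (toℚᵘ-ι (suc m)) ⟩
  ℚᵘ.mkℚᵘ (ℤ.+ 1) m ℚᵘ.* ℚᵘ.mkℚᵘ (ℤ.+ suc m) 0   ≈⟨ ℚᵘ.*≡* cross ⟩
  ℚᵘ.mkℚᵘ (ℤ.+ 1) 0                              ∎)
  where
  open ℚᵘ-Reasoning
  cross : ℤ.+ 1 ℤ.* ℤ.+ suc m ℤ.* ℤ.+ 1 ≡ ℤ.+ 1 ℤ.* ℤ.+ (suc m ℕ.* 1)
  cross = trans (trans (ℤ.*-identityʳ _) (ℤ.*-identityˡ _))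
                (sym (trans (ℤ.*-identityˡ _) (cong ℤ.+_ (ℕ.*-identityʳ (suc m)))))

nC0≡1 : ∀ n → n C 0 ≡ 1
nC0≡1 n = trans (nCk≡nC[n∸k] {0} {n} z≤n) (nCn≡1 n)

k≤n⇒nCk>0 : ∀ {n k} → k ≤ n → 0 < n C k
k≤n⇒nCk>0 {n} {zero}  _         = ℕ.≤-reflexive (sym (nC0≡1 n))
k≤n⇒nCk>0 {suc n} {suc k} (s≤s k≤n) = ℕ.<-≤-trans (k≤n⇒nCk>0 k≤n) (begin
  n C k                    ≤⟨ ℕ.m≤m+n (n C k) (n C suc k) ⟩
  n C k ℕ.+ n C suc k      ≡⟨ nCk+nC[k+1]≡[n+1]C[k+1] n k ⟩
  suc n C suc k            ∎)
  where open ℕ.≤-Reasoning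

[n+1]C[k+1]*[k+1]≡[n+1]*nCk : ∀ n k → (suc n C suc k) ℕ.* suc k ≡ suc n ℕ.* (n C k)
[n+1]C[k+1]*[k+1]≡[n+1]*nCk zero zero = refl
[n+1]C[k+1]*[k+1]≡[n+1]*nCk zero (suc k) = begin
  (1 C suc (suc k)) ℕ.* suc (suc k)   ≡⟨ cong (ℕ._* suc (suc k)) (k>n⇒nCk≡0 {1} {suc (suc k)} (s≤s (s≤s z≤n))) ⟩
  0                                   ≡⟨ cong (1 ℕ.*_) (k>n⇒nCk≡0 {0} {suc k} (s≤s z≤n)) ⟨
  1 ℕ.* (0 C suc k)                   ∎
  where open ≡-Reasoning
[n+1]C[k+1]*[k+1]≡[n+1]*nCk (suc n) zero = begin
  (suc (suc n) C 1) ℕ.* 1             ≡⟨ ℕ.*-identityʳ (suc (suc n) C 1) ⟩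
  suc (suc n) C 1                     ≡⟨ nC1≡n (suc (suc n)) ⟩
  suc (suc n)                         ≡⟨ ℕ.*-identityʳ (suc (suc n)) ⟨
  suc (suc n) ℕ.* 1                   ≡⟨ cong (suc (suc n) ℕ.*_) (nC0≡1 (suc n)) ⟨
  suc (suc n) ℕ.* (suc n C 0)         ∎
  where open ≡-Reasoning
[n+1]C[k+1]*[k+1]≡[n+1]*nCk (suc n) (suc k) = begin
  (suc (suc n) C suc (suc k)) ℕ.* suc (suc k)
    ≡⟨ cong (ℕ._* suc (suc k)) (nCk+nC[k+1]≡[n+1]C[k+1] (suc n) (suc k)) ⟨
  (a ℕ.+ b) ℕ.* suc (suc k)
    ≡⟨ expand a b k ⟩
  a ℕ.* suc k ℕ.+ a ℕ.+ b ℕ.* suc (suc k)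
    ≡⟨ cong₂ (λ u v → u ℕ.+ a ℕ.+ v) ([n+1]C[k+1]*[k+1]≡[n+1]*nCk n k)
                                     ([n+1]C[k+1]*[k+1]≡[n+1]*nCk n (suc k)) ⟩
  suc n ℕ.* (n C k) ℕ.+ a ℕ.+ suc n ℕ.* (n C suc k)
    ≡⟨ regroup n (n C k) (n C suc k) a ⟩
  suc n ℕ.* (n C k ℕ.+ n C suc k) ℕ.+ a
    ≡⟨ cong (λ u → suc n ℕ.* u ℕ.+ a) (nCk+nC[k+1]≡[n+1]C[k+1] n k) ⟩
  suc n ℕ.* a ℕ.+ a
    ≡⟨ ℕ.+-comm (suc n ℕ.* a) a ⟩
  suc (suc n) ℕ.* a ∎
  where
  open ≡-Reasoning
  a b : ℕ
  a = suc n C suc k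
  b = suc n C suc (suc k)
  expand : ∀ a b k → (a ℕ.+ b) ℕ.* suc (suc k) ≡ a ℕ.* suc k ℕ.+ a ℕ.+ b ℕ.* suc (suc k)
  expand = solve-∀
  regroup : ∀ n x y a → suc n ℕ.* x ℕ.+ a ℕ.+ suc n ℕ.* y ≡ suc n ℕ.* (x ℕ.+ y) ℕ.+ a
  regroup = solve-∀

∑0to-cong : ∀ n {f g : ℕ → ℚ} → (∀ j → f j ≡ g j) → ∑0to n f ≡ ∑0to n g
∑0to-cong zero    f≡g = f≡g 0
∑0to-cong (suc n) f≡g = cong₂ _+_ (∑0to-cong n f≡g) (f≡g (suc n))

∑1to-cong : ∀ p {f g : ℕ → ℚ} → (∀ k → k ≤ p → f k ≡ g k) → ∑1to p f ≡ ∑1to p g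
∑1to-cong zero    f≡g = refl
∑1to-cong (suc p) f≡g =
  cong₂ _+_ (∑1to-cong p (λ k k≤p → f≡g k (ℕ.m≤n⇒m≤1+n k≤p))) (f≡g (suc p) ℕ.≤-refl)

+-interchange : ∀ a b c d → (a + b) + (c + d) ≡ (a + c) + (b + d)
+-interchange = solve 4 (λ a b c d → (a :+ b) :+ (c :+ d) := (a :+ c) :+ (b :+ d)) refl

∑0to-distrib-+ : ∀ n (f g : ℕ → ℚ) → ∑0to n (λ j → f j + g j) ≡ ∑0to n f + ∑0to n g
∑0to-distrib-+ zero    f g = refl
∑0to-distrib-+ (suc n) f g = trans (cong (_+ (f (suc n) + g (suc n))) (∑0to-distrib-+ n f g))
  (+-interchange (∑0to n f) (∑0to n g) (f (suc n)) (g (suc n)))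

∑1to-distrib-+ : ∀ p (f g : ℕ → ℚ) → ∑1to p (λ k → f k + g k) ≡ ∑1to p f + ∑1to p g
∑1to-distrib-+ zero    f g = sym (+-identityʳ 0ℚ)
∑1to-distrib-+ (suc p) f g = trans (cong (_+ (f (suc p) + g (suc p))) (∑1to-distrib-+ p f g))
  (+-interchange (∑1to p f) (∑1to p g) (f (suc p)) (g (suc p)))

∑0to-distrib-- : ∀ n (f g : ℕ → ℚ) → ∑0to n (λ j → f j - g j) ≡ ∑0to n f - ∑0to n g
∑0to-distrib-- zero    f g = refl
∑0to-distrib-- (suc n) f g = trans (cong (_+ (f (suc n) - g (suc n))) (∑0to-distrib-- n f g))
  (solve 4 (λ a b c d → (a :- b) :+ (c :- d) := (a :+ c) :- (b :+ d)) refl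
     (∑0to n f) (∑0to n g) (f (suc n)) (g (suc n)))

∑0to-*ˡ : ∀ n c (f : ℕ → ℚ) → ∑0to n (λ j → c * f j) ≡ c * ∑0to n f
∑0to-*ˡ zero    c f = refl
∑0to-*ˡ (suc n) c f = trans (cong (_+ (c * f (suc n))) (∑0to-*ˡ n c f))
  (sym (*-distribˡ-+ c (∑0to n f) (f (suc n))))

∑1to-*ʳ : ∀ p c (f : ℕ → ℚ) → ∑1to p (λ k → f k * c) ≡ ∑1to p f * c
∑1to-*ʳ zero    c f = sym (*-zeroˡ c)
∑1to-*ʳ (suc p) c f = trans (cong (_+ (f (suc p) * c)) (∑1to-*ʳ p c f))
  (sym (*-distribʳ-+ c (∑1to p f) (f (suc p))))

∑0to-zero : ∀ n → ∑0to n (λ _ → 0ℚ) ≡ 0ℚ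
∑0to-zero zero    = refl
∑0to-zero (suc n) = cong (_+ 0ℚ) (∑0to-zero n)

∑1to-∑0to-comm : ∀ p n (f : ℕ → ℕ → ℚ) →
  ∑1to p (λ k → ∑0to n (f k)) ≡ ∑0to n (λ j → ∑1to p (λ k → f k j))
∑1to-∑0to-comm zero    n f = sym (∑0to-zero n)
∑1to-∑0to-comm (suc p) n f = trans (cong (_+ ∑0to n (f (suc p))) (∑1to-∑0to-comm p n f))
  (sym (∑0to-distrib-+ n (λ j → ∑1to p (λ k → f k j)) (f (suc p))))

PascalRecurrence : (ℕ → ℕ → ℚ) → Set
PascalRecurrence f = ∀ n p → f (suc n) (suc p) ≡ f n (suc p) + f (suc n) p

pascal-unique : ∀ {f g} → PascalRecurrence f → PascalRecurrence g →
                (∀ p → f 0 p ≡ g 0 p) → (∀ n → f n 0 ≡ g n 0) → ∀ n p → f n p ≡ g n p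
pascal-unique {f} {g} rec-f rec-g f≡g₀ₚ f≡gₙ₀ = go
  where
  go : ∀ n p → f n p ≡ g n p
  go zero    p       = f≡g₀ₚ p
  go (suc n) zero    = f≡gₙ₀ (suc n)
  go (suc n) (suc p) = trans (rec-f n p) (trans (cong₂ _+_ (go n (suc p)) (go (suc n) p)) (sym (rec-g n p)))

harmonicGap : ℕ → ℕ → ℚ
harmonicGap n p = ι ((n ℕ.+ p) C n) * (H (n ℕ.+ p) - H n)

reciprocalChooseSum : ℕ → ℕ → ℚ
reciprocalChooseSum n p = ∑1to p (λ k → recip k * ι ((n ℕ.+ p ∸ k) C n))

ιC*recip-absorb : ∀ m k → ι (suc m C suc k) * recip (suc m) ≡ ι (m C k) * recip (suc k)
ιC*recip-absorb m k = begin
  c * r                     ≡⟨ *-identityʳ (c * r) ⟨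
  c * r * 1ℚ                ≡⟨ cong (c * r *_) (recip-inverseˡ (suc k)) ⟨
  c * r * (s * ι (suc k))   ≡⟨ solve 4 (λ c r s k → c :* r :* (s :* k) := r :* s :* (c :* k)) refl c r s (ι (suc k)) ⟩
  r * s * (c * ι (suc k))   ≡⟨ cong (r * s *_) absorb ⟩
  r * s * (ι (suc m) * a)   ≡⟨ solve 4 (λ r s m a → r :* s :* (m :* a) := r :* m :* (a :* s)) refl r s (ι (suc m)) a ⟩
  r * ι (suc m) * (a * s)   ≡⟨ cong (_* (a * s)) (recip-inverseˡ (suc m)) ⟩
  1ℚ * (a * s)              ≡⟨ *-identityˡ (a * s) ⟩
  a * s                     ∎
  where
  open ≡-Reasoning
  c a r s : ℚ
  c = ι (suc m C suc k)
  a = ι (m C k)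
  r = recip (suc m)
  s = recip (suc k)
  absorb : c * ι (suc k) ≡ ι (suc m) * a
  absorb = trans (sym (ι-homo-* (suc m C suc k) (suc k)))
           (trans (cong ι ([n+1]C[k+1]*[k+1]≡[n+1]*nCk m k)) (ι-homo-* (suc m) (m C k)))

ιC*harmonicDiff-pascal : ∀ m k →
  ι (suc m C suc k) * (H (suc m) - H (suc k))
    ≡ ι (m C k) * (H m - H k) + ι (m C suc k) * (H m - H (suc k))
ιC*harmonicDiff-pascal m k = begin
  c * (H m + r - (H k + s))
    ≡⟨ solve 5 (λ c h r h′ s → c :* (h :+ r :- (h′ :+ s)) := c :* (h :- (h′ :+ s)) :+ c :* r) refl
               c (H m) r (H k) s ⟩
  c * (H m - (H k + s)) + c * r
    ≡⟨ cong (λ x → c * (H m - (H k + s)) + x) (ιC*recip-absorb m k) ⟩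
  c * (H m - (H k + s)) + a * s
    ≡⟨ cong (λ x → x * (H m - (H k + s)) + a * s) pascal ⟩
  (a + b) * (H m - (H k + s)) + a * s
    ≡⟨ solve 5 (λ a b h h′ s → (a :+ b) :* (h :- (h′ :+ s)) :+ a :* s := a :* (h :- h′) :+ b :* (h :- (h′ :+ s))) refl
               a b (H m) (H k) s ⟩
  a * (H m - H k) + b * (H m - (H k + s)) ∎
  where
  open ≡-Reasoning
  c a b r s : ℚ
  c = ι (suc m C suc k)
  a = ι (m C k)
  b = ι (m C suc k)
  r = recip (suc m)
  s = recip (suc k)
  pascal : c ≡ a + b
  pascal = trans (cong ι (sym (nCk+nC[k+1]≡[n+1]C[k+1] m k))) (ι-homo-+ (m C k) (m C suc k))

harmonicGap-pascal : PascalRecurrence harmonicGap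
harmonicGap-pascal n p = trans (ιC*harmonicDiff-pascal (n ℕ.+ suc p) n)
  (cong (λ m → harmonicGap n (suc p) + ι (m C suc n) * (H m - H (suc n))) (ℕ.+-suc n p))

reciprocalChooseSum-pascal : PascalRecurrence reciprocalChooseSum
reciprocalChooseSum-pascal n p = begin
  reciprocalChooseSum (suc n) (suc p)
    ≡⟨ ∑1to-cong (suc p) split ⟩
  ∑1to (suc p) (λ k → f k + g k)
    ≡⟨ ∑1to-distrib-+ (suc p) f g ⟩
  reciprocalChooseSum n (suc p) + (reciprocalChooseSum (suc n) p + g (suc p))
    ≡⟨ cong (λ x → reciprocalChooseSum n (suc p) + (reciprocalChooseSum (suc n) p + x)) g[1+p]≡0 ⟩
  reciprocalChooseSum n (suc p) + (reciprocalChooseSum (suc n) p + 0ℚ)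
    ≡⟨ cong (λ x → reciprocalChooseSum n (suc p) + x) (+-identityʳ _) ⟩
  reciprocalChooseSum n (suc p) + reciprocalChooseSum (suc n) p ∎
  where
  open ≡-Reasoning
  f g : ℕ → ℚ
  f k = recip k * ι ((n ℕ.+ suc p ∸ k) C n)
  g k = recip k * ι ((suc n ℕ.+ p ∸ k) C suc n)
  split : ∀ k → k ≤ suc p → recip k * ι ((suc n ℕ.+ suc p ∸ k) C suc n) ≡ f k + g k
  split k k≤1+p = begin
    recip k * ι ((suc n ℕ.+ suc p ∸ k) C suc n)
      ≡⟨ cong (λ x → recip k * ι (x C suc n)) (ℕ.+-∸-assoc 1 (ℕ.≤-trans k≤1+p (ℕ.m≤n+m (suc p) n))) ⟩
    recip k * ι (suc (n ℕ.+ suc p ∸ k) C suc n)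
      ≡⟨ cong (λ x → recip k * ι x) (nCk+nC[k+1]≡[n+1]C[k+1] (n ℕ.+ suc p ∸ k) n) ⟨
    recip k * ι ((n ℕ.+ suc p ∸ k) C n ℕ.+ (n ℕ.+ suc p ∸ k) C suc n)
      ≡⟨ cong (λ x → recip k * ι ((n ℕ.+ suc p ∸ k) C n ℕ.+ (x ∸ k) C suc n)) (ℕ.+-suc n p) ⟩
    recip k * ι ((n ℕ.+ suc p ∸ k) C n ℕ.+ (suc n ℕ.+ p ∸ k) C suc n)
      ≡⟨ cong (recip k *_) (ι-homo-+ ((n ℕ.+ suc p ∸ k) C n) ((suc n ℕ.+ p ∸ k) C suc n)) ⟩
    recip k * (ι ((n ℕ.+ suc p ∸ k) C n) + ι ((suc n ℕ.+ p ∸ k) C suc n))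
      ≡⟨ *-distribˡ-+ (recip k) _ _ ⟩
    f k + g k ∎
  g[1+p]≡0 : g (suc p) ≡ 0ℚ
  g[1+p]≡0 = begin
    recip (suc p) * ι ((n ℕ.+ p ∸ p) C suc n) ≡⟨ cong (λ x → recip (suc p) * ι (x C suc n)) (ℕ.m+n∸n≡m n p) ⟩
    recip (suc p) * ι (n C suc n)             ≡⟨ cong (λ x → recip (suc p) * ι x) (k>n⇒nCk≡0 (ℕ.n<1+n n)) ⟩
    recip (suc p) * 0ℚ                        ≡⟨ *-zeroʳ (recip (suc p)) ⟩
    0ℚ                                        ∎

harmonicGap≡reciprocalChooseSum : ∀ n p → harmonicGap n p ≡ reciprocalChooseSum n p
harmonicGap≡reciprocalChooseSum =
  pascal-unique harmonicGap-pascal reciprocalChooseSum-pascal at-n≡0 at-p≡0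
  where
  at-n≡0 : ∀ p → harmonicGap 0 p ≡ reciprocalChooseSum 0 p
  at-n≡0 p = begin
    ι (p C 0) * (H p - 0ℚ) ≡⟨ cong (λ x → ι x * (H p - 0ℚ)) (nC0≡1 p) ⟩
    1ℚ * (H p - 0ℚ)        ≡⟨ solve 1 (λ h → con 1ℚ :* (h :- con 0ℚ) := h) refl (H p) ⟩
    H p                    ≡⟨ ∑1to-cong p (λ k _ → sym (recip*ι[p∸k]C0 k)) ⟩
    reciprocalChooseSum 0 p ∎
    where
    open ≡-Reasoning
    recip*ι[p∸k]C0 : ∀ k → recip k * ι ((p ∸ k) C 0) ≡ recip k
    recip*ι[p∸k]C0 k = trans (cong (λ x → recip k * ι x) (nC0≡1 (p ∸ k))) (*-identityʳ (recip k))
  at-p≡0 : ∀ n → harmonicGap n 0 ≡ reciprocalChooseSum n 0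
  at-p≡0 n rewrite ℕ.+-identityʳ n =
    solve 2 (λ c h → c :* (h :- h) := con 0ℚ) refl (ι (n C n)) (H n)

H[n+p]≡H[n]+reciprocalChooseSum/C : ∀ n p →
  H (n ℕ.+ p) ≡ H n + recip ((n ℕ.+ p) C n) * reciprocalChooseSum n p
H[n+p]≡H[n]+reciprocalChooseSum/C n p = begin
  H (n ℕ.+ p)
    ≡⟨ solve 2 (λ h h′ → h′ := h :+ con 1ℚ :* (h′ :- h)) refl (H n) (H (n ℕ.+ p)) ⟩
  H n + 1ℚ * (H (n ℕ.+ p) - H n)
    ≡⟨ cong (λ x → H n + x * (H (n ℕ.+ p) - H n)) (recip-inverseˡ c) ⟨
  H n + recip c * ι c * (H (n ℕ.+ p) - H n)
    ≡⟨ cong (H n +_) (*-assoc (recip c) (ι c) (H (n ℕ.+ p) - H n)) ⟩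
  H n + recip c * harmonicGap n p
    ≡⟨ cong (λ x → H n + recip c * x) (harmonicGap≡reciprocalChooseSum n p) ⟩
  H n + recip c * reciprocalChooseSum n p ∎
  where
  open ≡-Reasoning
  c : ℕ
  c = (n ℕ.+ p) C n
  instance
    c≢0 : NonZero c
    c≢0 = ℕ.>-nonZero (k≤n⇒nCk>0 (ℕ.m≤m+n n p))

∑ιC*H*w-shift : ∀ n p (w : ℕ → ℚ) →
  ∑0to n (λ j → ι ((j ℕ.+ p) C j) * H j * w j)
    ≡ ∑0to n (λ j → ι ((j ℕ.+ p) C j) * H (j ℕ.+ p) * w j)
      - ∑1to p (λ k → recip k * ∑0to n (λ j → ι ((j ℕ.+ p ∸ k) C j) * w j))
∑ιC*H*w-shift n p w = begin
  ∑0to n lower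
    ≡⟨ solve 2 (λ x y → y := x :- (x :- y)) refl (∑0to n upper) (∑0to n lower) ⟩
  ∑0to n upper - (∑0to n upper - ∑0to n lower)
    ≡⟨ cong (λ x → ∑0to n upper - x) (sym correction) ⟩
  ∑0to n upper - ∑1to p (λ k → recip k * ∑0to n (λ j → ι ((j ℕ.+ p ∸ k) C j) * w j)) ∎
  where
  open ≡-Reasoning
  upper lower : ℕ → ℚ
  upper j = ι ((j ℕ.+ p) C j) * H (j ℕ.+ p) * w j
  lower j = ι ((j ℕ.+ p) C j) * H j * w j
  correction : ∑1to p (λ k → recip k * ∑0to n (λ j → ι ((j ℕ.+ p ∸ k) C j) * w j))
             ≡ ∑0to n upper - ∑0to n lower
  correction = begin
    ∑1to p (λ k → recip k * ∑0to n (λ j → ι ((j ℕ.+ p ∸ k) C j) * w j))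
      ≡⟨ ∑1to-cong p (λ k _ → sym (∑0to-*ˡ n (recip k) _)) ⟩
    ∑1to p (λ k → ∑0to n (λ j → recip k * (ι ((j ℕ.+ p ∸ k) C j) * w j)))
      ≡⟨ ∑1to-∑0to-comm p n _ ⟩
    ∑0to n (λ j → ∑1to p (λ k → recip k * (ι ((j ℕ.+ p ∸ k) C j) * w j)))
      ≡⟨ ∑0to-cong n (λ j → ∑1to-cong p (λ k _ → sym (*-assoc (recip k) _ (w j)))) ⟩
    ∑0to n (λ j → ∑1to p (λ k → recip k * ι ((j ℕ.+ p ∸ k) C j) * w j))
      ≡⟨ ∑0to-cong n (λ j → ∑1to-*ʳ p (w j) _) ⟩
    ∑0to n (λ j → reciprocalChooseSum j p * w j)
      ≡⟨ ∑0to-cong n (λ j → cong (_* w j) (sym (harmonicGap≡reciprocalChooseSum j p))) ⟩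
    ∑0to n (λ j → harmonicGap j p * w j)
      ≡⟨ ∑0to-cong n (λ j → solve 4 (λ c h h′ w → c :* (h′ :- h) :* w := c :* h′ :* w :- c :* h :* w) refl
                               (ι ((j ℕ.+ p) C j)) (H j) (H (j ℕ.+ p)) (w j)) ⟩
    ∑0to n (λ j → upper j - lower j)
      ≡⟨ ∑0to-distrib-- n upper lower ⟩
    ∑0to n upper - ∑0to n lower ∎

theorem9 : (n p : ℕ) →
    (∑0to n (λ j → ι ((j Data.Nat.+ p) C j) * ι ((2 Data.Nat.* (n ∸ j)) C (n ∸ j)) * ι (4 ^ j) * H j * O (n ∸ j))
      ≡ ∑0to n (λ j → ι ((j Data.Nat.+ p) C j) * ι ((2 Data.Nat.* (n ∸ j)) C (n ∸ j)) * ι (4 ^ j) * O (n ∸ j) * H (j Data.Nat.+ p))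
        - ∑1to p (λ k → recip k * ∑0to n (λ j → ι ((j Data.Nat.+ p ∸ k) C j) * ι ((2 Data.Nat.* (n ∸ j)) C (n ∸ j)) * ι (4 ^ j) * O (n ∸ j))))
    × (H (n Data.Nat.+ p)
      ≡ H n + recip ((n Data.Nat.+ p) C n) * ∑1to p (λ k → recip k * ι ((n Data.Nat.+ p ∸ k) C n)))
theorem9 n p = (begin
    ∑0to n (λ j → c j * b j * e j * H j * o j)
      ≡⟨ ∑0to-cong n lower-shape ⟩
    ∑0to n (λ j → c j * H j * w j)
      ≡⟨ ∑ιC*H*w-shift n p w ⟩
    ∑0to n (λ j → c j * H (j ℕ.+ p) * w j)
      - ∑1to p (λ k → recip k * ∑0to n (λ j → ι ((j ℕ.+ p ∸ k) C j) * w j))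
      ≡⟨ cong₂ _-_ (∑0to-cong n upper-shape)
                   (∑1to-cong p (λ k _ → cong (recip k *_) (∑0to-cong n (inner-shape k)))) ⟩
    ∑0to n (λ j → c j * b j * e j * o j * H (j ℕ.+ p))
      - ∑1to p (λ k → recip k * ∑0to n (λ j → ι ((j ℕ.+ p ∸ k) C j) * b j * e j * o j)) ∎)
  , H[n+p]≡H[n]+reciprocalChooseSum/C n p
  where
  open ≡-Reasoning
  c b e o w : ℕ → ℚ
  c j = ι ((j ℕ.+ p) C j)
  b j = ι ((2 ℕ.* (n ∸ j)) C (n ∸ j))
  e j = ι (4 ^ j)
  o j = O (n ∸ j)
  w j = b j * e j * o j
  lower-shape : ∀ j → c j * b j * e j * H j * o j ≡ c j * H j * w j
  lower-shape j = solve 5 (λ c b e h o → c :* b :* e :* h :* o := c :* h :* (b :* e :* o)) refl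
                    (c j) (b j) (e j) (H j) (o j)
  upper-shape : ∀ j → c j * H (j ℕ.+ p) * w j ≡ c j * b j * e j * o j * H (j ℕ.+ p)
  upper-shape j = solve 5 (λ c h b e o → c :* h :* (b :* e :* o) := c :* b :* e :* o :* h) refl
                    (c j) (H (j ℕ.+ p)) (b j) (e j) (o j)
  inner-shape : ∀ k j → ι ((j ℕ.+ p ∸ k) C j) * w j ≡ ι ((j ℕ.+ p ∸ k) C j) * b j * e j * o j
  inner-shape k j = solve 4 (λ a b e o → a :* (b :* e :* o) := a :* b :* e :* o) refl
                      (ι ((j ℕ.+ p ∸ k) C j)) (b j) (e j) (o j)
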